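{- Let $G=(V,E)$ be a graph and let $\le$ be a co-lex preorder on $G$. If $[v]_\le\in V/_\le$ satisfies $|[v]_\le|\ge2$, then there is at most one edge entering $[v]_\le$ in $G/_\le$.
   Context: $\Sigma$ is a finite alphabet with a fixed total order $\preceq$. A graph is $G=(V,E)$ with $V$ finite and $E\subseteq V\times V\times\Sigma$. Let $\#\notin\Sigma$ with $\#\prec a$ for all $a\in\Sigma$. For $v\in V$, $\lambda(v)$ is the set of labels of edges entering $v$ if $v$ has incoming edges, and $\{\#\}$ otherwise. Write $\lambda(u)\,\angle\,\lambda(v)$ iff $a\preceq b$ for all $a\in\lambda(u)$, $b\in\lambda(v)$. A co-lex relation on $G$ is a reflexive $R\subseteq V\times V$ such that (Axiom 1) $u\neq v$, $(u,v)\in R$ implies $\lambda(u)\,\angle\,\lambda(v)$; (Axiom 2) for $(u',u,a),(v',v,a)\in E$ with $u\neq v$ and $(u,v)\in R$, $(u',v')\in R$. A co-lex preorder is a transitive co-lex relation. For a preorder $\le$: $u\sim_\le v$ iff $u\le v$ and $v\le u$; $[v]_\le$ is the class of $v$; $V/_\le$ the set of classes; $G/_\le=(V/_\le,E/_\le)$ where $E/_\le=\{([u]_\le,[v]_\le,a):(u',v',a)\in E$ for some $u'\in[u]_\le$, $v'\in[v]_\le\}$. -}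

module Defs where

open import Data.Nat using (ℕ)
open import Data.Fin using (Fin)
open import Data.Fin.Base using () renaming (_≤_ to _≤ᶠ_)
open import Data.Bool using (Bool; true)
open import Data.Maybe using (Maybe; just; nothing)
open import Data.Product using (_×_; ∃; ∃-syntax)
open import Relation.Binary.PropositionalEquality using (_≡_; _≢_)
open import Relation.Nullary using (¬_)

-- Alphabet Σ = Fin σ with its standard total order (any finite totally
-- ordered alphabet is order-isomorphic to such a Fin σ).
-- A graph on V = Fin n over Σ: E is a subset of V × V × Σ, given by its
-- characteristic function;  (u , v , a) ∈ E  iff  E u v a ≡ true.
Graph : ℕ → ℕ → Set
Graph n σ = Fin n → Fin n → Fin σ → Bool

-- Extended labels Σ ∪ {#}: nothing = #, just a = a.
Label : ℕ → Set
Label σ = Maybe (Fin σ)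

data _≼_ {σ : ℕ} : Label σ → Label σ → Set where
  #≼   : ∀ {x} → nothing ≼ x
  a≼b  : ∀ {a b} → a ≤ᶠ b → just a ≼ just b

module _ {n σ : ℕ} (G : Graph n σ) where

  HasIncoming : Fin n → Set
  HasIncoming v = ∃[ u ] ∃[ a ] G u v a ≡ true

  data _∈λ_ : Label σ → Fin n → Set where
    lab  : ∀ {u v a} → G u v a ≡ true → just a ∈λ v
    hash : ∀ {v} → ¬ HasIncoming v → nothing ∈λ v

  _∠_ : Fin n → Fin n → Set
  u ∠ v = ∀ x y → x ∈λ u → y ∈λ v → x ≼ y

  record IsCoLexRelation (R : Fin n → Fin n → Set) : Set where
    field
      refl   : ∀ u → R u u
      axiom1 : ∀ u v → u ≢ v → R u v → u ∠ v
      axiom2 : ∀ u' u v' v a → G u' u a ≡ true → G v' v a ≡ true →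
               u ≢ v → R u v → R u' v'

  record IsCoLexPreorder (R : Fin n → Fin n → Set) : Set where
    field
      isCoLexRelation : IsCoLexRelation R
      trans           : ∀ u v w → R u v → R v w → R u w

  module Quotient (R : Fin n → Fin n → Set) where

    -- u ∼ v  iff  u ≤ v and v ≤ u; classes [u] = [v] iff u ∼ v.
    _∼_ : Fin n → Fin n → Set
    u ∼ v = R u v × R v u

    ClassSizeAtLeast2 : Fin n → Set
    ClassSizeAtLeast2 v = ∃[ u ] (u ≢ v × u ∼ v)

    QEdge : Fin n → Fin n → Fin σ → Set
    QEdge u v a = ∃[ u' ] ∃[ v' ] (u' ∼ u × v' ∼ v × G u' v' a ≡ true)

module Submission where

open import Defs
open import Data.Nat using (ℕ)
open import Data.Fin using (Fin; _≟_)
open import Data.Fin.Properties using (any?) renaming (≤-antisym to ≤ᶠ-antisym)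
open import Data.Bool using (true)
open import Data.Bool.Properties using () renaming (_≟_ to _≟ᵇ_)
open import Data.Maybe using (just)
open import Data.Product using (_×_; _,_; proj₁; proj₂; ∃-syntax)
open import Data.Empty using (⊥; ⊥-elim)
open import Function using (_∘_)
open import Relation.Nullary using (Dec; yes; no; ¬_)
open import Relation.Binary.PropositionalEquality as ≡ using (_≡_; _≢_; refl; sym; subst)

-- Two vertices whose label sets are mutually ∠ are entered by one common letter only,
-- and a vertex entered by some letter is never ∠-below a source, since # precedes every
-- letter.  The members of a class are pairwise ∠-related in both directions, so all
-- edges into the class carry the same letter and, by Axiom 2, their sources are
-- ≤-related.  Two edges into the same vertex p are compared through a second member of
-- the class, which by the above is not a source.

module _ {n σ : ℕ} (G : Graph n σ) where

  hasIncoming? : ∀ v → Dec (HasIncoming G v)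
  hasIncoming? v = any? λ u → any? λ a → G u v a ≟ᵇ true

  ∠-antisym-letters : ∀ {u v a b} → _∠_ G u v → _∠_ G v u →
                      _∈λ_ G (just a) u → _∈λ_ G (just b) v → a ≡ b
  ∠-antisym-letters u∠v v∠u a∈u b∈v with u∠v _ _ a∈u b∈v | v∠u _ _ b∈v a∈u
  ... | a≼b a≤b | a≼b b≤a = ≤ᶠ-antisym a≤b b≤a

  entered-not-∠-source : ∀ {u v a} → _∠_ G u v → _∈λ_ G (just a) u → ¬ HasIncoming G v → ⊥
  entered-not-∠-source u∠v a∈u ¬inc with u∠v _ _ a∈u (hash ¬inc)
  ... | ()

module CoLexPreorder {n σ : ℕ} (G : Graph n σ) (R : Fin n → Fin n → Set)
                     (P : IsCoLexPreorder G R) where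
  open IsCoLexPreorder P renaming (trans to R-trans)
  open IsCoLexRelation isCoLexRelation renaming (refl to R-refl)
  open Quotient G R

  ∼-refl : ∀ {u} → u ∼ u
  ∼-refl {u} = R-refl u , R-refl u

  ∼-sym : ∀ {u v} → u ∼ v → v ∼ u
  ∼-sym (uv , vu) = vu , uv

  ∼-trans : ∀ {u v w} → u ∼ v → v ∼ w → u ∼ w
  ∼-trans {u} {v} {w} (uv , vu) (vw , wv) = R-trans u v w uv vw , R-trans w v u wv vu

  in-edges-of-distinct-∼ : ∀ {x p a y q b} → p ≢ q → p ∼ q →
                           G x p a ≡ true → G y q b ≡ true → R x y × a ≡ b
  in-edges-of-distinct-∼ {x} {p} {a} {y} {q} {b} p≢q (pq , qp) xpa yqb =
    axiom2 x p y q a xpa (subst (λ c → G y q c ≡ true) (sym a≡b) yqb) p≢q pq , a≡b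
    where
    a≡b : a ≡ b
    a≡b = ∠-antisym-letters G (axiom1 p q p≢q pq) (axiom1 q p (p≢q ∘ sym) qp) (lab xpa) (lab yqb)

  another-member : ∀ {v} → ClassSizeAtLeast2 v → ∀ p → ∃[ z ] (z ∼ v × z ≢ p)
  another-member {v} (w , w≢v , w∼v) p with p ≟ v
  ... | yes refl = w , w∼v , w≢v
  ... | no p≢v   = v , ∼-refl , p≢v ∘ sym

  in-edges-of-class : ∀ {v} → ClassSizeAtLeast2 v → ∀ {x p a y q b} → p ∼ v → q ∼ v →
                      G x p a ≡ true → G y q b ≡ true → R x y × a ≡ b
  in-edges-of-class big {p = p} {q = q} p∼v q∼v xpa yqb with p ≟ q
  ... | no p≢q = in-edges-of-distinct-∼ p≢q (∼-trans p∼v (∼-sym q∼v)) xpa yqb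
  ... | yes refl with another-member big p
  ... | z , z∼v , z≢p with hasIncoming? G z
  ... | no ¬inc =
    ⊥-elim (entered-not-∠-source G (axiom1 p z (z≢p ∘ sym) (proj₁ (∼-trans p∼v (∼-sym z∼v)))) (lab xpa) ¬inc)
  ... | yes (t , c , tzc) =
    let xt , a≡c = in-edges-of-distinct-∼ (z≢p ∘ sym) (∼-trans p∼v (∼-sym z∼v)) xpa tzc
        ty , c≡b = in-edges-of-distinct-∼ z≢p (∼-trans z∼v (∼-sym q∼v)) tzc yqb
    in R-trans _ t _ xt ty , ≡.trans a≡c c≡b

lemma10 : ∀ {n σ : ℕ} (G : Graph n σ) (R : Fin n → Fin n → Set) →
          IsCoLexPreorder G R →
          ∀ (v : Fin n) → Quotient.ClassSizeAtLeast2 G R v →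
          ∀ (u₁ u₂ : Fin n) (a₁ a₂ : Fin σ) →
          Quotient.QEdge G R u₁ v a₁ → Quotient.QEdge G R u₂ v a₂ →
          Quotient._∼_ G R u₁ u₂ × a₁ ≡ a₂
lemma10 G R P v big u₁ u₂ a₁ a₂ (x , p , x∼u₁ , p∼v , xpa₁) (y , q , y∼u₂ , q∼v , yqa₂) =
  ∼-trans (∼-sym x∼u₁) (∼-trans x∼y y∼u₂) , proj₂ forward
  where
  open CoLexPreorder G R P
  open Quotient G R using (_∼_)

  forward : R x y × a₁ ≡ a₂
  forward = in-edges-of-class big p∼v q∼v xpa₁ yqa₂

  backward : R y x × a₂ ≡ a₁
  backward = in-edges-of-class big q∼v p∼v yqa₂ xpa₁

  x∼y : x ∼ y
  x∼y = proj₁ forward , proj₁ backward
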